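{- Let $m_1,\dots,m_k$ be positive integers, $n_i=2^{m_i}$, and $G=K_{n_1}\square K_{n_2}\square\cdots\square K_{n_k}$ with all edge weights $1$. Then $c(G,\mathbf{1})=\sum_{i=1}^{k}c(K_{n_i},\mathbf{1})$ (and this equals $\sum_{i=1}^k m_i$).
   Context: $K_n$ is the complete graph on $n$ vertices; $G\square H$ is the Cartesian product (vertex set $V(G)\times V(H)$, $(u,u')\sim(v,v')$ iff $u=v$ and $u'v'\in E(H)$, or $u'=v'$ and $uv\in E(G)$). With all weights $1$, distances are graph distances $d$. A binary addressing of length $m$ is a map $f:V\to\{0,1\}^m$ with $d(u,v)\le d_H(f(u),f(v))$ for all $u,v$ ($d_H$ Hamming distance); $c(G,\mathbf{1})$ is the minimum such $m$. -}

module Defs where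

open import Data.Nat using (ℕ; zero; suc; _+_; _≤_; _^_)
open import Data.Fin using (Fin)
open import Data.Bool using (Bool; true; false)
open import Data.Vec using (Vec; []; _∷_)
open import Data.List using (List; []; _∷_)
open import Data.Product using (_×_; Σ; ∃)
open import Data.Sum using (_⊎_)
open import Relation.Binary.PropositionalEquality using (_≡_; _≢_)

record Graph : Set₁ where
  field
    Vertex : Set
    Adj    : Vertex → Vertex → Set
open Graph public

K : ℕ → Graph
K n = record { Vertex = Fin n ; Adj = λ u v → u ≢ v }

_□_ : Graph → Graph → Graph
G □ H = record
  { Vertex = Vertex G × Vertex H
  ; Adj = λ p q →
      (Data.Product.proj₁ p ≡ Data.Product.proj₁ q × Adj H (Data.Product.proj₂ p) (Data.Product.proj₂ q))
      ⊎ (Data.Product.proj₂ p ≡ Data.Product.proj₂ q × Adj G (Data.Product.proj₁ p) (Data.Product.proj₁ q))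
  }

data Walk (G : Graph) : Vertex G → Vertex G → ℕ → Set where
  here : ∀ {u} → Walk G u u 0
  step : ∀ {u v w ℓ} → Adj G u v → Walk G v w ℓ → Walk G u w (suc ℓ)

IsDist : (G : Graph) → Vertex G → Vertex G → ℕ → Set
IsDist G u v d = Walk G u v d × (∀ ℓ → Walk G u v ℓ → d ≤ ℓ)

hamming : ∀ {m} → Vec Bool m → Vec Bool m → ℕ
hamming [] [] = 0
hamming (true ∷ xs) (true ∷ ys) = hamming xs ys
hamming (false ∷ xs) (false ∷ ys) = hamming xs ys
hamming (true ∷ xs) (false ∷ ys) = suc (hamming xs ys)
hamming (false ∷ xs) (true ∷ ys) = suc (hamming xs ys)

IsAddressing : (G : Graph) (m : ℕ) → (Vertex G → Vec Bool m) → Set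
IsAddressing G m f = ∀ u v d → IsDist G u v d → d ≤ hamming (f u) (f v)

IsAddressingNumber : Graph → ℕ → Set
IsAddressingNumber G c =
  Σ (Vertex G → Vec Bool c) (IsAddressing G c)
  × (∀ m (f : Vertex G → Vec Bool m) → IsAddressing G m f → c ≤ m)

-- K_{2^{m_1}} □ (K_{2^{m_2}} □ ( ... □ K_{2^{m_k}})) for the nonempty list m_1, m_2 ∷ ... ∷ m_k.
prodK : ℕ → List ℕ → Graph
prodK m [] = K (2 ^ m)
prodK m (m' ∷ ms) = K (2 ^ m) □ prodK m' ms

sumL : List ℕ → ℕ
sumL [] = 0
sumL (x ∷ xs) = x + sumL xs

{-# OPTIONS --safe #-}
-- Label the vertices of K (2 ^ m) bijectively by the binary words of length m: distinct
-- vertices are at distance 1 and receive distinct words, so the labelling is an addressing.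
-- In a Cartesian product the distance is the sum of the coordinate distances, and Hamming
-- distance is additive under concatenation, so concatenated labels address the product with
-- m₁ + ⋯ + mₖ bits. Conversely, an addressing of a connected graph is injective (distinct
-- vertices are at positive distance), and the product has 2 ^ (m₁ + ⋯ + mₖ) vertices, so no
-- addressing is shorter.
module Submission where

open import Defs
open import Data.Nat using (ℕ; zero; suc; _+_; _^_; _<_; _≤_; z≤n; s≤s)
open import Data.Nat.Properties
open import Data.Fin using (Fin) renaming (_≟_ to _≟ᶠ_)
open import Data.Fin.Properties using (2↔Bool; *↔×; injective⇒≤)
open import Data.Bool using (Bool; true; false)
open import Data.Vec using (Vec; []; _∷_; _++_; take; drop; uncons)
open import Data.Vec.Properties using (take++drop≡id; ++-injective)
open import Data.List using (List; []; _∷_)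
open import Data.List.Relation.Unary.All using (All; universal)
open import Data.Product using (_×_; _,_; proj₁; proj₂; uncurry)
open import Data.Product.Properties using (×-≡,≡→≡)
open import Data.Product.Function.NonDependent.Propositional using (_×-↔_)
open import Data.Sum using (inj₁; inj₂)
open import Data.Empty using (⊥-elim)
open import Function using (_∘_)
open import Function.Bundles using (_↔_; _↣_; mk↔ₛ′; mk↣; Inverse; Injection)
open import Function.Definitions using (Injective)
open import Function.Construct.Composition using (_↔-∘_; _↣-∘_)
open import Function.Properties.Inverse using (↔-sym; ↔⇒↣)
open import Relation.Nullary using (yes; no)
open import Relation.Binary.PropositionalEquality

private
  variable
    G A B : Graph
    k ℓ m n : ℕ

hamming-refl : (x : Vec Bool n) → hamming x x ≡ 0
hamming-refl []          = refl
hamming-refl (true ∷ x)  = hamming-refl x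
hamming-refl (false ∷ x) = hamming-refl x

hamming≡0⇒≡ : (x y : Vec Bool n) → hamming x y ≡ 0 → x ≡ y
hamming≡0⇒≡ []          []          _ = refl
hamming≡0⇒≡ (true ∷ x)  (true ∷ y)  e = cong (true ∷_) (hamming≡0⇒≡ x y e)
hamming≡0⇒≡ (false ∷ x) (false ∷ y) e = cong (false ∷_) (hamming≡0⇒≡ x y e)

hamming-++ : (x x' : Vec Bool m) (y y' : Vec Bool n) →
             hamming (x ++ y) (x' ++ y') ≡ hamming x x' + hamming y y'
hamming-++ []          []           y y' = refl
hamming-++ (true ∷ x)  (true ∷ x')  y y' = hamming-++ x x' y y'
hamming-++ (false ∷ x) (false ∷ x') y y' = hamming-++ x x' y y'
hamming-++ (true ∷ x)  (false ∷ x') y y' = cong suc (hamming-++ x x' y y')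
hamming-++ (false ∷ x) (true ∷ x')  y y' = cong suc (hamming-++ x x' y y')

_++ʷ_ : ∀ {u v w} → Walk G u v k → Walk G v w ℓ → Walk G u w (k + ℓ)
here       ++ʷ q = q
step a p   ++ʷ q = step a (p ++ʷ q)

walkˡ : ∀ {a a'} (b : Vertex B) → Walk A a a' k → Walk (A □ B) (a , b) (a' , b) k
walkˡ b here       = here
walkˡ b (step x p) = step (inj₂ (refl , x)) (walkˡ b p)

walkʳ : ∀ {b b'} (a : Vertex A) → Walk B b b' k → Walk (A □ B) (a , b) (a , b') k
walkʳ a here       = here
walkʳ a (step x p) = step (inj₁ (refl , x)) (walkʳ a p)

walk-≢⇒1≤length : ∀ {u v} → u ≢ v → Walk G u v k → 1 ≤ k
walk-≢⇒1≤length u≢v here       = ⊥-elim (u≢v refl)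
walk-≢⇒1≤length u≢v (step _ _) = s≤s z≤n

IsDist-≤0⇒≡ : ∀ {u v} → IsDist G u v k → k ≤ 0 → u ≡ v
IsDist-≤0⇒≡ (here , _) z≤n = refl

IsDistanceFunction : (G : Graph) → (Vertex G → Vertex G → ℕ) → Set
IsDistanceFunction G δ = ∀ u v → IsDist G u v (δ u v)

module _ {δ : Vertex G → Vertex G → ℕ} where

  walk-length-lowerBound : (∀ u → δ u u ≡ 0) →
                           (∀ {u v} → Adj G u v → ∀ w → δ u w ≤ suc (δ v w)) →
                           ∀ {u w} → Walk G u w k → δ u w ≤ k
  walk-length-lowerBound δ-refl δ-step {u} here = ≤-reflexive (δ-refl u)
  walk-length-lowerBound δ-refl δ-step {w = w} (step a p) =
    ≤-trans (δ-step a w) (s≤s (walk-length-lowerBound δ-refl δ-step p))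

  module _ (isDist : IsDistanceFunction G δ) where

    dist-refl : ∀ u → δ u u ≡ 0
    dist-refl u = n≤0⇒n≡0 (proj₂ (isDist u u) 0 here)

    dist-step : ∀ {u v} → Adj G u v → ∀ w → δ u w ≤ suc (δ v w)
    dist-step {u} {v} a w = proj₂ (isDist u w) _ (step a (proj₁ (isDist v w)))

    addressing-injective : ∀ {f : Vertex G → Vec Bool m} →
                           IsAddressing G m f → Injective _≡_ _≡_ f
    addressing-injective {f = f} addr {u} {v} fu≡fv =
      IsDist-≤0⇒≡ (isDist u v) (begin
        δ u v                  ≤⟨ addr u v (δ u v) (isDist u v) ⟩
        hamming (f u) (f v)    ≡⟨ cong (hamming (f u)) (sym fu≡fv) ⟩
        hamming (f u) (f u)    ≡⟨ hamming-refl (f u) ⟩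
        0                      ∎)
      where open ≤-Reasoning

discreteDist : Fin n → Fin n → ℕ
discreteDist u v with u ≟ᶠ v
... | yes _ = 0
... | no  _ = 1

discreteDist-isDistanceFunction : IsDistanceFunction (K n) discreteDist
discreteDist-isDistanceFunction u v with u ≟ᶠ v
... | yes refl = here , λ _ _ → z≤n
... | no  u≢v  = step u≢v here , λ _ → walk-≢⇒1≤length u≢v

sumDist : (Vertex A → Vertex A → ℕ) → (Vertex B → Vertex B → ℕ) →
          Vertex (A □ B) → Vertex (A □ B) → ℕ
sumDist δᴬ δᴮ (a , b) (a' , b') = δᴬ a a' + δᴮ b b'

sumDist-isDistanceFunction : ∀ {δᴬ δᴮ} →
  IsDistanceFunction A δᴬ → IsDistanceFunction B δᴮ →
  IsDistanceFunction (A □ B) (sumDist {A = A} {B = B} δᴬ δᴮ)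
sumDist-isDistanceFunction {A = A} {B = B} {δᴬ} {δᴮ} isDistᴬ isDistᴮ (a , b) (a' , b') =
  walkˡ b (proj₁ (isDistᴬ a a')) ++ʷ walkʳ a' (proj₁ (isDistᴮ b b')) ,
  λ _ → walk-length-lowerBound sumDist-refl sumDist-step
  where
  δ : Vertex (A □ B) → Vertex (A □ B) → ℕ
  δ = sumDist {A = A} {B = B} δᴬ δᴮ

  sumDist-refl : ∀ u → δ u u ≡ 0
  sumDist-refl (a , b) = cong₂ _+_ (dist-refl isDistᴬ a) (dist-refl isDistᴮ b)

  sumDist-step : ∀ {u v} → Adj (A □ B) u v → ∀ w → δ u w ≤ suc (δ v w)
  sumDist-step {a , b} {_ , b'} (inj₁ (refl , x)) (c , d) = begin
    δᴬ a c + δᴮ b d          ≤⟨ +-monoʳ-≤ (δᴬ a c) (dist-step isDistᴮ x d) ⟩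
    δᴬ a c + suc (δᴮ b' d)   ≡⟨ +-suc (δᴬ a c) (δᴮ b' d) ⟩
    suc (δᴬ a c + δᴮ b' d)   ∎
    where open ≤-Reasoning
  sumDist-step {a , b} (inj₂ (refl , x)) (c , d) =
    +-monoˡ-≤ (δᴮ b d) (dist-step isDistᴬ x c)

∷↔× : ∀ {X : Set} → Vec X (suc n) ↔ (X × Vec X n)
∷↔× = mk↔ₛ′ uncons (uncurry _∷_) (λ _ → refl) (λ { (x ∷ xs) → refl })

++↔× : ∀ {X : Set} m → (Vec X m × Vec X n) ↔ Vec X (m + n)
++↔× m = mk↔ₛ′ (uncurry _++_) (λ xs → take m xs , drop m xs) (take++drop≡id m)
  λ (ys , zs) → ×-≡,≡→≡ (++-injective (take m (ys ++ zs)) ys (take++drop≡id m (ys ++ zs)))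

Vec-Bool↔Fin-2^ : ∀ m → Vec Bool m ↔ Fin (2 ^ m)
Vec-Bool↔Fin-2^ zero    =
  mk↔ₛ′ (λ _ → Fin.zero) (λ _ → []) (λ { Fin.zero → refl ; (Fin.suc ()) }) (λ { [] → refl })
Vec-Bool↔Fin-2^ (suc m) =
  ↔-sym *↔× ↔-∘ ((↔-sym 2↔Bool ×-↔ Vec-Bool↔Fin-2^ m) ↔-∘ ∷↔×)

2^-cancel-≤ : 2 ^ m ≤ 2 ^ n → m ≤ n
2^-cancel-≤ 2^m≤2^n = ≮⇒≥ (λ n<m → <⇒≱ (^-monoʳ-< 2 (s≤s (s≤s z≤n)) n<m) 2^m≤2^n)

Vec-Bool-↣⇒≤ : Vec Bool m ↣ Vec Bool n → m ≤ n
Vec-Bool-↣⇒≤ {m} {n} g = 2^-cancel-≤ (injective⇒≤ (Injection.injective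
  (↔⇒↣ (Vec-Bool↔Fin-2^ n) ↣-∘ (g ↣-∘ ↔⇒↣ (↔-sym (Vec-Bool↔Fin-2^ m))))))

record HammingLabelling (G : Graph) (S : ℕ) : Set where
  field
    dist         : Vertex G → Vertex G → ℕ
    isDist       : IsDistanceFunction G dist
    label        : Vertex G ↔ Vec Bool S
    dist≤hamming : ∀ u v → dist u v ≤ hamming (Inverse.to label u) (Inverse.to label v)

  open Inverse label public using (to)

  labelling⇒addressingNumber : IsAddressingNumber G S
  labelling⇒addressingNumber = (to , isAddressing) , minimal
    where
    isAddressing : IsAddressing G S to
    isAddressing u v d (_ , d-minimal) =
      ≤-trans (d-minimal (dist u v) (proj₁ (isDist u v))) (dist≤hamming u v)

    minimal : ∀ c (f : Vertex G → Vec Bool c) → IsAddressing G c f → S ≤ c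
    minimal _ f addr =
      Vec-Bool-↣⇒≤ (mk↣ (addressing-injective isDist {f = f} addr) ↣-∘ ↔⇒↣ (↔-sym label))

open HammingLabelling using (labelling⇒addressingNumber)

labellingK : ∀ m → HammingLabelling (K (2 ^ m)) m
labellingK m = record
  { dist         = discreteDist
  ; isDist       = discreteDist-isDistanceFunction
  ; label        = label
  ; dist≤hamming = discreteDist≤hamming
  }
  where
  label : Fin (2 ^ m) ↔ Vec Bool m
  label = ↔-sym (Vec-Bool↔Fin-2^ m)
  open Inverse label using (to)

  discreteDist≤hamming : ∀ u v → discreteDist u v ≤ hamming (to u) (to v)
  discreteDist≤hamming u v with u ≟ᶠ v
  ... | yes _ = z≤n
  ... | no u≢v = n≢0⇒n>0 λ h≡0 →
    u≢v (Injection.injective (↔⇒↣ label) (hamming≡0⇒≡ (to u) (to v) h≡0))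

labelling□ : HammingLabelling A m → HammingLabelling B n → HammingLabelling (A □ B) (m + n)
labelling□ {A = A} {m = m} {B = B} LA LB = record
  { dist         = sumDist {A = A} {B = B} A.dist B.dist
  ; isDist       = sumDist-isDistanceFunction A.isDist B.isDist
  ; label        = ++↔× m ↔-∘ (A.label ×-↔ B.label)
  ; dist≤hamming = λ (a , b) (a' , b') → begin
      A.dist a a' + B.dist b b'
        ≤⟨ +-mono-≤ (A.dist≤hamming a a') (B.dist≤hamming b b') ⟩
      hamming (A.to a) (A.to a') + hamming (B.to b) (B.to b')
        ≡⟨ hamming-++ (A.to a) (A.to a') (B.to b) (B.to b') ⟨
      hamming (A.to a ++ B.to b) (A.to a' ++ B.to b')  ∎
  }
  where
  module A = HammingLabelling LA
  module B = HammingLabelling LB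
  open ≤-Reasoning

labellingProdK : ∀ m ms → HammingLabelling (prodK m ms) (sumL (m ∷ ms))
labellingProdK m []        =
  subst (HammingLabelling (K (2 ^ m))) (sym (+-identityʳ m)) (labellingK m)
labellingProdK m (m' ∷ ms) = labelling□ (labellingK m) (labellingProdK m' ms)

corollary10 : (m : ℕ) (ms : List ℕ) → 0 < m → All (0 <_) ms →
    IsAddressingNumber (prodK m ms) (sumL (m ∷ ms))
    × All (λ mi → IsAddressingNumber (K (2 ^ mi)) mi) (m ∷ ms)
corollary10 m ms _ _ =
  labelling⇒addressingNumber (labellingProdK m ms) ,
  universal (labelling⇒addressingNumber ∘ labellingK) (m ∷ ms)
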